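{- Let $B$ and $B'$ be two distinct vertex-resilient blocks of a digraph $G=(V,E)$. Then $|B\cap B'|\le 1$.
   Context: Two distinct vertices $v,w$ of $G$ are vertex-resilient, written $v\leftrightarrow_{\mathrm{vr}} w$, if for every vertex $z\notin\{v,w\}$, $v$ and $w$ lie in the same strongly connected component of $G\setminus z$. A vertex-resilient block is a maximal set $B\subseteq V$ with $|B|\ge 2$ such that $u\leftrightarrow_{\mathrm{vr}} v$ for all distinct $u,v\in B$. -}

module Defs where

open import Data.Nat using (ℕ; _≤_)
open import Data.Fin using (Fin)
open import Data.Fin.Subset using (Subset; _∈_; _⊆_; ∣_∣)
open import Data.Product using (_×_)
open import Relation.Binary.PropositionalEquality using (_≡_; _≢_)
open import Level using (Level)

-- A digraph G = (V, E) with vertex set V = Fin n and edge relation E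
-- (E u v means there is an edge u → v).

-- ReachAvoid E z u v : there is a directed path from u to v in G ∖ z,
-- i.e. a path all of whose vertices (including u and v) differ from z.
data ReachAvoid {n : ℕ} {ℓ : Level} (E : Fin n → Fin n → Set ℓ) (z : Fin n)
       : Fin n → Fin n → Set ℓ where
  here : ∀ {u} → u ≢ z → ReachAvoid E z u u
  step : ∀ {u x v} → u ≢ z → E u x → ReachAvoid E z x v → ReachAvoid E z u v

SameSCCAvoid : {n : ℕ} {ℓ : Level} → (Fin n → Fin n → Set ℓ) → Fin n → Fin n → Fin n → Set ℓ
SameSCCAvoid E z u v = ReachAvoid E z u v × ReachAvoid E z v u

VertexResilient : {n : ℕ} {ℓ : Level} → (Fin n → Fin n → Set ℓ) → Fin n → Fin n → Set ℓ
VertexResilient E v w = v ≢ w × (∀ z → z ≢ v → z ≢ w → SameSCCAvoid E z v w)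

PairwiseVR : {n : ℕ} {ℓ : Level} → (Fin n → Fin n → Set ℓ) → Subset n → Set ℓ
PairwiseVR E B = ∀ u v → u ∈ B → v ∈ B → u ≢ v → VertexResilient E u v

IsVRBlock : {n : ℕ} {ℓ : Level} → (Fin n → Fin n → Set ℓ) → Subset n → Set ℓ
IsVRBlock {n} {ℓ} E B =
  2 ≤ ∣ B ∣ × PairwiseVR E B
  × (∀ (C : Subset n) → 2 ≤ ∣ C ∣ → PairwiseVR E C → B ⊆ C → C ⊆ B)

module Submission where

-- Suppose two distinct vertex-resilient blocks B and B′ shared
-- two distinct vertices x and y.  Then B ∪ B′ is pairwise vertex-resilient:
-- pairs inside B or inside B′ are covered by the blocks themselves, and for
-- u ∈ B, v ∈ B′ and a deleted vertex z ∉ {u, v}, one of x, y — call it m —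
-- survives the deletion, so the strong connections u ⇄ m (given by B) and
-- m ⇄ v (given by B′) in G ∖ z compose to u ⇄ v.  Maximality of the blocks
-- then forces B = B ∪ B′ = B′, a contradiction.
--
-- Since ≤ on ℕ is decidable, the corollary follows constructively.

open import Defs
open import Data.Nat using (ℕ; _≤_; s≤s)
open import Data.Nat.Properties using (≤-trans; _≤?_; ≰⇒>)
open import Data.Fin using (Fin; zero; suc; _≟_)
open import Data.Fin.Properties using (suc-injective)
open import Data.Fin.Subset using (Subset; _∩_; _∪_; ∣_∣; _∈_; _⊆_; inside; outside)
open import Data.Fin.Subset.Properties
  using (x∈p∩q⁻; x∈p∪q⁻; p⊆p∪q; q⊆p∪q; ⊆-antisym; p⊆q⇒∣p∣≤∣q∣)
open import Data.Vec using (_∷_; here; there)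
open import Data.Product using (∃; _×_; _,_; proj₂)
open import Data.Sum using (inj₁; inj₂)
open import Relation.Nullary using (yes; no; contradiction)
open import Relation.Binary.PropositionalEquality using (_≡_; refl; _≢_; ≢-sym; sym; trans)
open import Level using (Level)

TwoDistinct : {n : ℕ} → Subset n → Set
TwoDistinct {n} p = ∃ λ (x : Fin n) → ∃ λ (y : Fin n) → x ≢ y × x ∈ p × y ∈ p

member-of-∣p∣≥1 : {n : ℕ} (p : Subset n) → 1 ≤ ∣ p ∣ → ∃ λ x → x ∈ p
member-of-∣p∣≥1 (inside ∷ p) _ = zero , here
member-of-∣p∣≥1 (outside ∷ p) size with member-of-∣p∣≥1 p size
... | x , x∈p = suc x , there x∈p

twoDistinct-of-∣p∣≥2 : {n : ℕ} (p : Subset n) → 2 ≤ ∣ p ∣ → TwoDistinct p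
twoDistinct-of-∣p∣≥2 (inside ∷ p) (s≤s size) with member-of-∣p∣≥1 p size
... | y , y∈p = zero , suc y , (λ ()) , here , there y∈p
twoDistinct-of-∣p∣≥2 (outside ∷ p) size with twoDistinct-of-∣p∣≥2 p size
... | x , y , x≢y , x∈p , y∈p =
  suc x , suc y , (λ sx≡sy → x≢y (suc-injective sx≡sy)) , there x∈p , there y∈p

survivor : {n : ℕ} {p : Subset n} → TwoDistinct p → (z : Fin n) → ∃ λ m → m ∈ p × z ≢ m
survivor (x , y , x≢y , x∈p , y∈p) z with z ≟ x
... | yes refl = y , y∈p , x≢y
... | no z≢x = x , x∈p , z≢x

module _ {ℓ : Level} {n : ℕ} (E : Fin n → Fin n → Set ℓ) where

  reach-trans : ∀ {z u v w} → ReachAvoid E z u v → ReachAvoid E z v w → ReachAvoid E z u w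
  reach-trans (here u≢z) q = q
  reach-trans (step u≢z edge p) q = step u≢z edge (reach-trans p q)

  sameSCC-sym : ∀ {z u v} → SameSCCAvoid E z u v → SameSCCAvoid E z v u
  sameSCC-sym (forward , backward) = backward , forward

  sameSCC-trans : ∀ {z u v w} →
    SameSCCAvoid E z u v → SameSCCAvoid E z v w → SameSCCAvoid E z u w
  sameSCC-trans (uv , vu) (vw , wv) = reach-trans uv vw , reach-trans wv vu

  vertexResilient-sym : ∀ {u v} → VertexResilient E u v → VertexResilient E v u
  vertexResilient-sym (u≢v , connected) =
    ≢-sym u≢v , λ z z≢v z≢u → sameSCC-sym (connected z z≢u z≢v)

  sameSCC-within : ∀ {B} → PairwiseVR E B → ∀ {z u m} → u ∈ B → m ∈ B →
    z ≢ u → z ≢ m → SameSCCAvoid E z u m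
  sameSCC-within pw {z} {u} {m} u∈B m∈B z≢u z≢m with u ≟ m
  ... | yes refl = here (≢-sym z≢u) , here (≢-sym z≢u)
  ... | no u≢m = proj₂ (pw u m u∈B m∈B u≢m) z z≢u z≢m

  -- Two pairwise vertex-resilient sets sharing two distinct vertices
  -- make every u ∈ B and v ∈ B′ vertex-resilient, routing through a
  -- common vertex that survives the deletion.
  resilient-across : ∀ {B B′} → PairwiseVR E B → PairwiseVR E B′ → TwoDistinct (B ∩ B′) →
    ∀ {u v} → u ∈ B → v ∈ B′ → u ≢ v → VertexResilient E u v
  resilient-across {B} {B′} pw pw′ shared {u} {v} u∈B v∈B′ u≢v = u≢v , connected
    where
    connected : ∀ z → z ≢ u → z ≢ v → SameSCCAvoid E z u v
    connected z z≢u z≢v with survivor shared z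
    ... | m , m∈B∩B′ , z≢m with x∈p∩q⁻ B B′ m∈B∩B′
    ... | m∈B , m∈B′ = sameSCC-trans (sameSCC-within pw u∈B m∈B z≢u z≢m)
                                     (sameSCC-within pw′ m∈B′ v∈B′ z≢m z≢v)

  union-pairwiseVR : ∀ {B B′} → PairwiseVR E B → PairwiseVR E B′ → TwoDistinct (B ∩ B′) →
    PairwiseVR E (B ∪ B′)
  union-pairwiseVR {B} {B′} pw pw′ shared u v u∈ v∈ u≢v
    with x∈p∪q⁻ B B′ u∈ | x∈p∪q⁻ B B′ v∈
  ... | inj₁ u∈B | inj₁ v∈B = pw u v u∈B v∈B u≢v
  ... | inj₂ u∈B′ | inj₂ v∈B′ = pw′ u v u∈B′ v∈B′ u≢v
  ... | inj₁ u∈B | inj₂ v∈B′ = resilient-across pw pw′ shared u∈B v∈B′ u≢v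
  ... | inj₂ u∈B′ | inj₁ v∈B =
    vertexResilient-sym (resilient-across pw pw′ shared v∈B u∈B′ (≢-sym u≢v))

  block-absorbs : ∀ {B C} → IsVRBlock E B → PairwiseVR E C → B ⊆ C → B ≡ C
  block-absorbs (size , _ , maximal) pwC B⊆C =
    ⊆-antisym B⊆C (maximal _ (≤-trans size (p⊆q⇒∣p∣≤∣q∣ B⊆C)) pwC B⊆C)

corollary1 : {ℓ : Level} (n : ℕ) (E : Fin n → Fin n → Set ℓ) (B B′ : Subset n) →
    IsVRBlock E B → IsVRBlock E B′ → B ≢ B′ → ∣ B ∩ B′ ∣ ≤ 1
corollary1 n E B B′ block@(_ , pw , _) block′@(_ , pw′ , _) B≢B′ with ∣ B ∩ B′ ∣ ≤? 1
... | yes small = small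
... | no large = contradiction (trans B≡B∪B′ (sym B′≡B∪B′)) B≢B′
  where
  unionVR : PairwiseVR E (B ∪ B′)
  unionVR = union-pairwiseVR E pw pw′ (twoDistinct-of-∣p∣≥2 (B ∩ B′) (≰⇒> large))
  B≡B∪B′ : B ≡ B ∪ B′
  B≡B∪B′ = block-absorbs E block unionVR (p⊆p∪q B′)
  B′≡B∪B′ : B′ ≡ B ∪ B′
  B′≡B∪B′ = block-absorbs E block′ unionVR (q⊆p∪q B B′)
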